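{- Let $M$ be the shortest-path metric of a connected unweighted graph on $n$ vertices with maximum degree $d$ and diameter $\Delta$, and let $s\in\mathbb{N}$. Then $M$ can be $\bigl(2+\frac{\Delta}{s}\bigr)$ path-embedded into a tree metric of size $n\,d^{s}$.
   Context: A tree metric is the shortest-path metric on (a subset of) the vertices of a finite tree with nonnegative edge weights. A multi-embedding of $M$ in $N$ is a partial surjective function $f$ from $N$ onto $M$; it is non-contractive if $d_N(u,v)\ge d_M(f(u),f(v))$ for all $u,v$ in the domain of $f$. For a path (finite sequence of points) $p=\langle u_1,\dots,u_m\rangle$, $\ell(p)=\sum_{i=1}^{m-1}d(u_i,u_{i+1})$. $M$ is $\alpha$ path-embedded in $N$ if there is a non-contractive multi-embedding $f$ such that for every path $p=\langle u_1,\dots,u_m\rangle$ in $M$ there is a path $p'=\langle u'_1,\dots,u'_m\rangle$ in $N$ with $f(u'_i)=u_i$ and $\ell(p')\le\alpha\,\ell(p)$. The size of the target is its number of points. -}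

module Defs where

open import Data.Nat using (ℕ; zero; suc; _+_; _≤_; _<_)
open import Data.Bool using (Bool; true; false; T)
open import Data.Fin using (Fin)
open import Data.List using (List; []; _∷_; length; filter; allFin)
open import Data.List.Relation.Unary.Unique.Propositional using (Unique)
open import Data.Product using (Σ; ∃; _×_; _,_)
open import Data.Empty using (⊥)
open import Data.Integer using (+_)
open import Data.Maybe using (Maybe; just)
open import Data.List.Relation.Binary.Pointwise using (Pointwise)
open import Relation.Nullary using (¬_)
open import Relation.Nullary.Decidable using (T?)
open import Relation.Binary.PropositionalEquality using (_≡_)
open import Data.Rational as ℚ using (ℚ; 0ℚ)

record Graph (n : ℕ) : Set where
  field
    adj    : Fin n → Fin n → Bool
    sym    : ∀ u v → adj u v ≡ adj v u
    irrefl : ∀ u → adj u u ≡ false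
open Graph public

module _ {n : ℕ} (G : Graph n) where

  data Walk : Fin n → Fin n → Set where
    here : ∀ {u} → Walk u u
    step : ∀ {u w} (v : Fin n) → T (adj G u v) → Walk v w → Walk u w

  len : ∀ {u w} → Walk u w → ℕ
  len here = 0
  len (step _ _ r) = suc (len r)

  inner : ∀ {u w} → Walk u w → List (Fin n)
  inner here = []
  inner (step {u} _ _ r) = u ∷ inner r

  Connected : Set
  Connected = ∀ u v → Walk u v

  IsCycle : ∀ {u} → Walk u u → Set
  IsCycle c = (3 ≤ len c) × Unique (inner c)

  Acyclic : Set
  Acyclic = ∀ u (c : Walk u u) → ¬ IsCycle c

  IsTree : Set
  IsTree = Connected × Acyclic

  IsDist : Fin n → Fin n → ℕ → Set
  IsDist u v k = Σ (Walk u v) (λ w → len w ≡ k) × (∀ (w : Walk u v) → k ≤ len w)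

  IsShortestPathMetric : (Fin n → Fin n → ℕ) → Set
  IsShortestPathMetric dM = ∀ u v → IsDist u v (dM u v)

  degree : Fin n → ℕ
  degree u = length (filter (λ v → T? (adj G u v)) (allFin n))

  MaxDegree : ℕ → Set
  MaxDegree d = (∀ u → degree u ≤ d) × ∃ λ u → degree u ≡ d

  Diameter : (Fin n → Fin n → ℕ) → ℕ → Set
  Diameter dM Δ = (∀ u v → dM u v ≤ Δ) × ∃ λ u → ∃ λ v → dM u v ≡ Δ

  wlen : (Fin n → Fin n → ℚ) → ∀ {u w} → Walk u w → ℚ
  wlen wt here = 0ℚ
  wlen wt (step {u} v _ r) = wt u v ℚ.+ wlen wt r

  IsWDist : (Fin n → Fin n → ℚ) → Fin n → Fin n → ℚ → Set
  IsWDist wt u v r = Σ (Walk u v) (λ w → wlen wt w ≡ r) × (∀ (w : Walk u v) → r ℚ.≤ wlen wt w)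

record WeightedTree (m : ℕ) : Set where
  field
    graph   : Graph m
    isTree  : IsTree graph
    wt      : Fin m → Fin m → ℚ
    wt-sym  : ∀ u v → wt u v ≡ wt v u
    wt-nonneg : ∀ u v → T (adj graph u v) → 0ℚ ℚ.≤ wt u v
    dT      : Fin m → Fin m → ℚ
    dT-spec : ∀ u v → IsWDist graph wt u v (dT u v)
open WeightedTree public

record TreeMetric (k : ℕ) : Set where
  field
    m     : ℕ
    tree  : WeightedTree m
    point : Fin k → Fin m
    point-inj : ∀ x y → point x ≡ point y → x ≡ y
  dist : Fin k → Fin k → ℚ
  dist x y = dT tree (point x) (point y)
open TreeMetric public

ℓℕ : ∀ {A : Set} → (A → A → ℕ) → List A → ℕ
ℓℕ d [] = 0
ℓℕ d (x ∷ []) = 0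
ℓℕ d (x ∷ y ∷ p) = d x y + ℓℕ d (y ∷ p)

ℓℚ : ∀ {A : Set} → (A → A → ℚ) → List A → ℚ
ℓℚ d [] = 0ℚ
ℓℚ d (x ∷ []) = 0ℚ
ℓℚ d (x ∷ y ∷ p) = d x y ℚ.+ ℓℚ d (y ∷ p)

-- M (points Fin n, metric dM) is α path-embedded in the tree metric N,
-- via a non-contractive multi-embedding f (partial surjection from N onto M).
PathEmbedded : ∀ {n k} → (Fin n → Fin n → ℕ) → TreeMetric k → ℚ → Set
PathEmbedded {n} {k} dM N α =
  Σ (Fin k → Maybe (Fin n)) λ f →
    (∀ x → ∃ λ u → f u ≡ just x)
  × (∀ u v x y → f u ≡ just x → f v ≡ just y → (+ (dM x y) ℚ./ 1) ℚ.≤ dist N u v)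
  × (∀ (p : List (Fin n)) → ∃ λ (p′ : List (Fin k)) →
        Pointwise (λ u′ u → f u′ ≡ just u) p′ p
      × ℓℚ (dist N) p′ ℚ.≤ α ℚ.* (+ (ℓℕ dM p) ℚ./ 1))

module Submission where

-- Build a tree with a hub, a root for every vertex r of G at distance Δ/2 from the
-- hub, and below each root the complete d-ary tree of depth s, whose node r c
-- (c a word over Fin d) stands for the vertex reached from r by choosing
-- neighbours as c dictates; an edge costs 1 if its letter names a real edge and
-- 0 otherwise.  Per root, the first d^s words in order of length are the points,
-- each mapped to the vertex it stands for.  A tree path between two points
-- projects to a walk of G or crosses the hub at cost Δ, so the map is
-- non-contractive.  A path of G is lifted greedily: from node r c, extend c by a
-- shortest route to the next vertex while the word has length at most t, and
-- otherwise jump through the hub to the root of the next vertex.  An extension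
-- costs at most the graph distance and a jump at most |c| + Δ; charging
-- (1 + Δ/s) per letter of c pays for the jump, since jumps only happen once
-- |c| plus the next step exceeds t, giving stretch 2 + Δ/s.  For d ≥ 2 all words
-- shorter than s are points, so t = s - 1; for d = 1 the graph is a single edge,
-- Δ ≤ 1, and t = 0 suffices.

open import Defs hiding (sym)
open import Data.Nat using (ℕ; _≤_)
open import Data.Fin using (Fin)

module HalfUnits where

  open import Data.Nat using (ℕ; suc; _+_; _*_; _≤_)
  import Data.Nat.Properties as ℕₚ
  open import Data.Integer as ℤ using (+_)
  import Data.Integer.Properties as ℤₚ
  open import Data.Rational as ℚ using (ℚ; 0ℚ; toℚᵘ)
  import Data.Rational.Properties as ℚₚ
  open import Data.Rational.Unnormalised as ℚᵘ using (mkℚᵘ; *≤*; *≡*)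
  import Data.Rational.Unnormalised.Properties as ℚᵘₚ
  open import Data.Nat.Solver using (module +-*-Solver)
  open +-*-Solver
  open import Relation.Binary.PropositionalEquality
  open import Data.List using (List; []; _∷_)

  toℚᵘ-/ : ∀ a k → toℚᵘ (+ a ℚ./ suc k) ℚᵘ.≃ mkℚᵘ (+ a) k
  toℚᵘ-/ a k = ℚₚ.toℚᵘ-fromℚᵘ (mkℚᵘ (+ a) k)

  /-≤-/ : ∀ a k b j → a * suc j ≤ b * suc k → (+ a ℚ./ suc k) ℚ.≤ (+ b ℚ./ suc j)
  /-≤-/ a k b j a*j≤b*k = ℚₚ.toℚᵘ-cancel-≤
    (ℚᵘₚ.≤-respˡ-≃ (ℚᵘₚ.≃-sym (toℚᵘ-/ a k)) (ℚᵘₚ.≤-respʳ-≃ (ℚᵘₚ.≃-sym (toℚᵘ-/ b j))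
      (*≤* (subst₂ ℤ._≤_ (ℤₚ.pos-* a (suc j)) (ℤₚ.pos-* b (suc k)) (ℤ.+≤+ a*j≤b*k)))))

  -- Abstract, so that type checking never normalises rational arithmetic.
  abstract
    half : ℕ → ℚ
    half a = + a ℚ./ 2

    half-0 : half 0 ≡ 0ℚ
    half-0 = refl

    half-mono-≤ : ∀ {a b} → a ≤ b → half a ℚ.≤ half b
    half-mono-≤ {a} {b} a≤b = /-≤-/ a 1 b 1 (ℕₚ.*-monoˡ-≤ 2 a≤b)

    half-+ : ∀ a b → half a ℚ.+ half b ≡ half (a + b)
    half-+ a b = ℚₚ.toℚᵘ-injective (ℚᵘₚ.≃-trans (ℚₚ.toℚᵘ-homo-+ (half a) (half b))
      (ℚᵘₚ.≃-trans (ℚᵘₚ.+-cong (toℚᵘ-/ a 1) (toℚᵘ-/ b 1))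
      (ℚᵘₚ.≃-trans (*≡* cross) (ℚᵘₚ.≃-sym (toℚᵘ-/ (a + b) 1)))))
      where
      open ≡-Reasoning
      cross : (+ a ℤ.* + 2 ℤ.+ + b ℤ.* + 2) ℤ.* + 2 ≡ + (a + b) ℤ.* + (2 * 2)
      cross = begin
        (+ a ℤ.* + 2 ℤ.+ + b ℤ.* + 2) ℤ.* + 2
          ≡⟨ cong₂ (λ x y → (x ℤ.+ y) ℤ.* + 2) (sym (ℤₚ.pos-* a 2)) (sym (ℤₚ.pos-* b 2)) ⟩
        (+ (a * 2) ℤ.+ + (b * 2)) ℤ.* + 2   ≡⟨ sym (ℤₚ.pos-* (a * 2 + b * 2) 2) ⟩
        + ((a * 2 + b * 2) * 2)             ≡⟨ cong +_ (solve 2 (λ a b → (a :* con 2 :+ b :* con 2) :* con 2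
                                                                      := (a :+ b) :* (con 2 :* con 2)) refl a b) ⟩
        + ((a + b) * (2 * 2))               ≡⟨ ℤₚ.pos-* (a + b) (2 * 2) ⟩
        + (a + b) ℤ.* + (2 * 2)             ∎

    ≤-half : ∀ a b → a * 2 ≤ b → (+ a ℚ./ 1) ℚ.≤ half b
    ≤-half a b a*2≤b = /-≤-/ a 0 b 1 (ℕₚ.≤-trans a*2≤b (ℕₚ.≤-reflexive (sym (ℕₚ.*-identityʳ b))))

    half-≤-stretch : ∀ C L Δ s → suc s * C ≤ (4 * suc s + 2 * Δ) * L →
      half C ℚ.≤ ((+ 2 ℚ./ 1) ℚ.+ (+ Δ ℚ./ suc s)) ℚ.* (+ L ℚ./ 1)
    half-≤-stretch C L Δ s SC≤ = ℚₚ.toℚᵘ-cancel-≤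
      (ℚᵘₚ.≤-respˡ-≃ (ℚᵘₚ.≃-sym (toℚᵘ-/ C 1)) (ℚᵘₚ.≤-respʳ-≃ (ℚᵘₚ.≃-sym unnormalised) (*≤* cross)))
      where
      unnormalised : toℚᵘ (((+ 2 ℚ./ 1) ℚ.+ (+ Δ ℚ./ suc s)) ℚ.* (+ L ℚ./ 1)) ℚᵘ.≃
                     ((mkℚᵘ (+ 2) 0 ℚᵘ.+ mkℚᵘ (+ Δ) s) ℚᵘ.* mkℚᵘ (+ L) 0)
      unnormalised = ℚᵘₚ.≃-trans (ℚₚ.toℚᵘ-homo-* ((+ 2 ℚ./ 1) ℚ.+ (+ Δ ℚ./ suc s)) (+ L ℚ./ 1))
        (ℚᵘₚ.*-cong (ℚᵘₚ.≃-trans (ℚₚ.toℚᵘ-homo-+ (+ 2 ℚ./ 1) (+ Δ ℚ./ suc s))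
                                 (ℚᵘₚ.+-cong (toℚᵘ-/ 2 0) (toℚᵘ-/ Δ s))) (toℚᵘ-/ L 0))
      open ≡-Reasoning
      rhs : + ((2 * suc s + Δ * 1) * L * 2) ≡ (+ 2 ℤ.* + (suc s) ℤ.+ + Δ ℤ.* + 1) ℤ.* + L ℤ.* + 2
      rhs = begin
        + ((2 * suc s + Δ * 1) * L * 2)                 ≡⟨ ℤₚ.pos-* ((2 * suc s + Δ * 1) * L) 2 ⟩
        + ((2 * suc s + Δ * 1) * L) ℤ.* + 2             ≡⟨ cong (ℤ._* + 2) (ℤₚ.pos-* (2 * suc s + Δ * 1) L) ⟩
        + (2 * suc s + Δ * 1) ℤ.* + L ℤ.* + 2           ≡⟨ cong (λ x → x ℤ.* + L ℤ.* + 2) (ℤₚ.pos-+ (2 * suc s) (Δ * 1)) ⟩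
        (+ (2 * suc s) ℤ.+ + (Δ * 1)) ℤ.* + L ℤ.* + 2   ≡⟨ cong₂ (λ x y → (x ℤ.+ y) ℤ.* + L ℤ.* + 2) (ℤₚ.pos-* 2 (suc s)) (ℤₚ.pos-* Δ 1) ⟩
        (+ 2 ℤ.* + (suc s) ℤ.+ + Δ ℤ.* + 1) ℤ.* + L ℤ.* + 2 ∎
      cross : + C ℤ.* + (1 * suc s * 1) ℤ.≤ (+ 2 ℤ.* + (suc s) ℤ.+ + Δ ℤ.* + 1) ℤ.* + L ℤ.* + 2
      cross = subst₂ ℤ._≤_ (ℤₚ.pos-* C (1 * suc s * 1)) rhs (ℤ.+≤+ (subst₂ _≤_
        (solve 2 (λ c s → s :* c := c :* (con 1 :* s :* con 1)) refl C (suc s))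
        (solve 3 (λ s δ l → (con 4 :* s :+ con 2 :* δ) :* l := (con 2 :* s :+ δ :* con 1) :* l :* con 2) refl (suc s) Δ L)
        SC≤))

  ℓℚ-half : ∀ {A : Set} (D : A → A → ℕ) (xs : List A) → ℓℚ (λ a b → half (D a b)) xs ≡ half (ℓℕ D xs)
  ℓℚ-half D [] = sym half-0
  ℓℚ-half D (x ∷ []) = sym half-0
  ℓℚ-half D (x ∷ y ∷ xs) = trans (cong (half (D x y) ℚ.+_) (ℓℚ-half D (y ∷ xs))) (half-+ (D x y) _)

module Walks {n : ℕ} (G : Graph n) where

  open import Data.Nat using (ℕ; suc; _+_)
  import Data.Nat.Properties as ℕₚ
  open import Data.Fin using (Fin)
  open import Data.Bool using (T)
  open import Data.Product using (Σ; _,_)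
  open import Data.Rational as ℚ using (ℚ)
  open import Relation.Binary.PropositionalEquality
  open HalfUnits

  infixr 5 _++ʷ_

  _++ʷ_ : ∀ {a b c} → Walk G a b → Walk G b c → Walk G a c
  here ++ʷ r = r
  step v e w ++ʷ r = step v e (w ++ʷ r)

  len-++ʷ : ∀ {a b c} (w : Walk G a b) (r : Walk G b c) → len G (w ++ʷ r) ≡ len G w + len G r
  len-++ʷ here r = refl
  len-++ʷ (step v e w) r = cong suc (len-++ʷ w r)

  adj-sym : ∀ {u v} → T (adj G u v) → T (adj G v u)
  adj-sym {u} {v} = subst T (Graph.sym G u v)

  reverseʷ : ∀ {a b} → Walk G a b → Walk G b a
  reverseʷ here = here
  reverseʷ (step {u} v e w) = reverseʷ w ++ʷ step u (adj-sym e) here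

  len-reverseʷ : ∀ {a b} (w : Walk G a b) → len G (reverseʷ w) ≡ len G w
  len-reverseʷ here = refl
  len-reverseʷ (step {u} v e w) =
    trans (len-++ʷ (reverseʷ w) _) (trans (cong (_+ 1) (len-reverseʷ w)) (ℕₚ.+-comm (len G w) 1))

  module Weighted (ω : Fin n → Fin n → ℕ) where

    weight : ∀ {a b} → Walk G a b → ℕ
    weight here = 0
    weight (step {u} v e w) = ω u v + weight w

    weight-++ʷ : ∀ {a b c} (w : Walk G a b) (r : Walk G b c) → weight (w ++ʷ r) ≡ weight w + weight r
    weight-++ʷ here r = refl
    weight-++ʷ (step {u} v e w) r = trans (cong (ω u v +_) (weight-++ʷ w r)) (sym (ℕₚ.+-assoc (ω u v) _ _))

    weight-reverseʷ : (∀ u v → ω u v ≡ ω v u) → ∀ {a b} (w : Walk G a b) → weight (reverseʷ w) ≡ weight w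
    weight-reverseʷ ω-sym here = refl
    weight-reverseʷ ω-sym (step {u} v e w) = begin
      weight (reverseʷ w ++ʷ step u (adj-sym e) here) ≡⟨ weight-++ʷ (reverseʷ w) _ ⟩
      weight (reverseʷ w) + (ω v u + 0)              ≡⟨ cong₂ _+_ (weight-reverseʷ ω-sym w) (trans (ℕₚ.+-identityʳ _) (ω-sym v u)) ⟩
      weight w + ω u v                               ≡⟨ ℕₚ.+-comm (weight w) _ ⟩
      ω u v + weight w                               ∎
      where open ≡-Reasoning

    wlen-half : ∀ {a b} (w : Walk G a b) → wlen G (λ u v → half (ω u v)) w ≡ half (weight w)
    wlen-half here = sym half-0
    wlen-half (step {u} v e w) = trans (cong (half (ω u v) ℚ.+_) (wlen-half w)) (half-+ (ω u v) (weight w))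

    WalkOfWeight : Fin n → Fin n → ℕ → Set
    WalkOfWeight a b X = Σ (Walk G a b) (λ w → weight w ≡ X)

    castᵂ : ∀ {a a′ b b′ X X′} → a ≡ a′ → b ≡ b′ → X ≡ X′ → WalkOfWeight a b X → WalkOfWeight a′ b′ X′
    castᵂ refl refl refl w = w

    emptyᵂ : ∀ {a} → WalkOfWeight a a 0
    emptyᵂ = here , refl

    edgeᵂ : ∀ {a b} → T (adj G a b) → WalkOfWeight a b (ω a b)
    edgeᵂ {a} {b} e = step b e here , ℕₚ.+-identityʳ _

    _++ᵂ_ : ∀ {a b c X Y} → WalkOfWeight a b X → WalkOfWeight b c Y → WalkOfWeight a c (X + Y)
    (w , p) ++ᵂ (r , q) = w ++ʷ r , trans (weight-++ʷ w r) (cong₂ _+_ p q)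

    reverseᵂ : (∀ u v → ω u v ≡ ω v u) → ∀ {a b X} → WalkOfWeight a b X → WalkOfWeight b a X
    reverseᵂ ω-sym (w , p) = reverseʷ w , trans (weight-reverseʷ ω-sym w) p

module ListLookup where

  open import Data.Nat using (ℕ; zero; suc; _≤_; _<_; s≤s; z≤n)
  open import Data.List using (List; []; _∷_; length)
  open import Data.List.Membership.Propositional using (_∈_)
  open import Data.List.Relation.Unary.Any using (here; there)
  open import Data.Product using (∃; _×_; _,_)
  open import Data.Sum using (_⊎_; inj₁; inj₂)
  open import Data.Empty using (⊥-elim)
  open import Relation.Nullary using (¬_)
  open import Relation.Binary.PropositionalEquality

  lookupOr : ∀ {A : Set} → List A → A → ℕ → A
  lookupOr [] a _ = a
  lookupOr (x ∷ xs) a zero = x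
  lookupOr (x ∷ xs) a (suc i) = lookupOr xs a i

  lookupOr-default-or-∈ : ∀ {A : Set} (xs : List A) a i → lookupOr xs a i ≡ a ⊎ lookupOr xs a i ∈ xs
  lookupOr-default-or-∈ [] a i = inj₁ refl
  lookupOr-default-or-∈ (x ∷ xs) a zero = inj₂ (here refl)
  lookupOr-default-or-∈ (x ∷ xs) a (suc i) with lookupOr-default-or-∈ xs a i
  ... | inj₁ ≡a = inj₁ ≡a
  ... | inj₂ ∈xs = inj₂ (there ∈xs)

  ∈⇒lookupOr : ∀ {A : Set} {x : A} (xs : List A) a → x ∈ xs → ∃ λ i → i < length xs × lookupOr xs a i ≡ x
  ∈⇒lookupOr (y ∷ xs) a (here refl) = zero , s≤s z≤n , refl
  ∈⇒lookupOr (y ∷ xs) a (there x∈xs) with ∈⇒lookupOr xs a x∈xs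
  ... | i , i<len , eq = suc i , s≤s i<len , eq

  ∈-∈-≢⇒2≤length : ∀ {A : Set} {x y : A} (xs : List A) → x ∈ xs → y ∈ xs → ¬ x ≡ y → 2 ≤ length xs
  ∈-∈-≢⇒2≤length (z ∷ []) (here refl) (here refl) x≢y = ⊥-elim (x≢y refl)
  ∈-∈-≢⇒2≤length (z ∷ []) (here _) (there ())
  ∈-∈-≢⇒2≤length (z ∷ []) (there ()) _
  ∈-∈-≢⇒2≤length (z ∷ w ∷ xs) _ _ _ = s≤s (s≤s z≤n)

module ShortestPaths {n : ℕ} (G : Graph n) (dM : Fin n → Fin n → ℕ) (sp : IsShortestPathMetric G dM) where

  open import Data.Nat using (ℕ; suc; _+_; _*_; _≤_; _<_; z≤n; s≤s)
  import Data.Nat.Properties as ℕₚ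
  open import Data.Fin as Fin using (Fin)
  import Data.Fin.Properties as Finₚ
  open import Data.Bool using (true; false; T; if_then_else_)
  open import Data.List using (List; []; _∷_; _++_; length; filter; allFin)
  open import Data.List.Membership.Propositional using (_∈_)
  import Data.List.Membership.Propositional.Properties as ∈ₚ
  open import Data.Product using (Σ; ∃; _×_; _,_; proj₁; proj₂)
  open import Data.Sum using (_⊎_; inj₁; inj₂)
  open import Data.Empty using (⊥-elim)
  open import Relation.Nullary using (yes; no)
  open import Relation.Nullary.Decidable using (T?)
  open import Relation.Binary.PropositionalEquality
  open Walks G
  open ListLookup

  dM-≤-len : ∀ {x y} (w : Walk G x y) → dM x y ≤ len G w
  dM-≤-len {x} {y} = proj₂ (sp x y)

  dM-refl : ∀ x → dM x x ≡ 0
  dM-refl x = ℕₚ.n≤0⇒n≡0 (dM-≤-len here)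

  dM-triangle : ∀ x y z → dM x z ≤ dM x y + dM y z
  dM-triangle x y z with proj₁ (sp x y) | proj₁ (sp y z)
  ... | w , ∣w∣≡ | r , ∣r∣≡ =
    ℕₚ.≤-trans (dM-≤-len (w ++ʷ r)) (ℕₚ.≤-reflexive (trans (len-++ʷ w r) (cong₂ _+_ ∣w∣≡ ∣r∣≡)))

  2*dM-triangle : ∀ {x y z a b} → 2 * dM x y ≤ a → 2 * dM y z ≤ b → 2 * dM x z ≤ a + b
  2*dM-triangle {x} {y} {z} xy≤ yz≤ = ℕₚ.≤-trans (ℕₚ.*-monoʳ-≤ 2 (dM-triangle x y z))
    (ℕₚ.≤-trans (ℕₚ.≤-reflexive (ℕₚ.*-distribˡ-+ 2 (dM x y) _)) (ℕₚ.+-mono-≤ xy≤ yz≤))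

  dM-adj : ∀ {x y} → T (adj G x y) → dM x y ≤ 1
  dM-adj {x} {y} e = dM-≤-len (step y e here)

  neighbours : Fin n → List (Fin n)
  neighbours u = filter (λ v → T? (adj G u v)) (allFin n)

  ∈-neighbours⁻ : ∀ {u v} → v ∈ neighbours u → T (adj G u v)
  ∈-neighbours⁻ {u} v∈ = proj₂ (∈ₚ.∈-filter⁻ (λ v → T? (adj G u v)) {xs = allFin n} v∈)

  ∈-neighbours⁺ : ∀ {u v} → T (adj G u v) → v ∈ neighbours u
  ∈-neighbours⁺ {u} {v} = ∈ₚ.∈-filter⁺ (λ v → T? (adj G u v)) (∈ₚ.∈-allFin v)

  connected⇒1≤maxDegree : 2 ≤ n → Connected G → ∀ {d} → (∀ u → degree G u ≤ d) → 1 ≤ d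
  connected⇒1≤maxDegree (s≤s (s≤s _)) connected degree≤d with connected Fin.zero (Fin.suc Fin.zero)
  ... | step v e w = ℕₚ.≤-trans (∈ₚ.∈-length (∈-neighbours⁺ e)) (degree≤d Fin.zero)

  -- A shortest walk of length 2 from x would visit a neighbour with two distinct neighbours.
  degree≤1⇒dM≤1 : (∀ u → degree G u ≤ 1) → ∀ x y → dM x y ≤ 1
  degree≤1⇒dM≤1 degree≤1 x y with sp x y
  ... | (here , ∣w∣≡) , _ = subst (_≤ 1) ∣w∣≡ z≤n
  ... | (step a e here , ∣w∣≡) , _ = subst (_≤ 1) ∣w∣≡ (s≤s z≤n)
  ... | (step a e₁ (step b e₂ r) , ∣w∣≡) , minimal with b Fin.≟ x
  ...   | yes refl = ⊥-elim (ℕₚ.<-irrefl refl (ℕₚ.<-≤-trans (subst (len G r <_) ∣w∣≡ (ℕₚ.n≤1+n _)) (minimal r)))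
  ...   | no b≢x = ⊥-elim (ℕₚ.<-irrefl refl (ℕₚ.<-≤-trans
            (∈-∈-≢⇒2≤length (neighbours a) (∈-neighbours⁺ e₂) (∈-neighbours⁺ (adj-sym e₁)) b≢x) (degree≤1 a)))

  -- A route from v is a word over Fin d, read as successive choices among
  -- at most d neighbours; a letter beyond the degree means "stay put".
  -- Route costs are in half units: 2 per real edge.
  module Routes (d : ℕ) (degree≤d : ∀ u → degree G u ≤ d) where

    neighbour : Fin n → Fin d → Fin n
    neighbour v i = lookupOr (neighbours v) v (Fin.toℕ i)

    neighbour-adj-or-self : ∀ v i → T (adj G v (neighbour v i)) ⊎ neighbour v i ≡ v
    neighbour-adj-or-self v i with lookupOr-default-or-∈ (neighbours v) v (Fin.toℕ i)
    ... | inj₁ ≡v = inj₂ ≡v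
    ... | inj₂ ∈ns = inj₁ (∈-neighbours⁻ ∈ns)

    neighbour-surjective : ∀ {v w} → T (adj G v w) → ∃ λ (i : Fin d) → neighbour v i ≡ w
    neighbour-surjective {v} e with ∈⇒lookupOr (neighbours v) v (∈-neighbours⁺ e)
    ... | i , i<len , eq =
      Fin.fromℕ< (ℕₚ.<-≤-trans i<len (degree≤d v)) ,
      trans (cong (lookupOr (neighbours v) v) (Finₚ.toℕ-fromℕ< _)) eq

    stepCost : Fin n → Fin d → ℕ
    stepCost v i = if adj G v (neighbour v i) then 2 else 0

    stepCost≤2 : ∀ v i → stepCost v i ≤ 2
    stepCost≤2 v i with adj G v (neighbour v i)
    ... | true = ℕₚ.≤-refl
    ... | false = z≤n

    stepCost-adj : ∀ v i → T (adj G v (neighbour v i)) → stepCost v i ≡ 2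
    stepCost-adj v i e with adj G v (neighbour v i)
    ... | true = refl

    2*dM≤stepCost : ∀ v i → 2 * dM v (neighbour v i) ≤ stepCost v i × 2 * dM (neighbour v i) v ≤ stepCost v i
    2*dM≤stepCost v i with neighbour-adj-or-self v i
    ... | inj₁ e rewrite stepCost-adj v i e = ℕₚ.*-monoʳ-≤ 2 (dM-adj e) , ℕₚ.*-monoʳ-≤ 2 (dM-adj (adj-sym e))
    ... | inj₂ ≡v rewrite ≡v | dM-refl v = z≤n , z≤n

    follow : Fin n → List (Fin d) → Fin n
    follow v [] = v
    follow v (i ∷ c) = follow (neighbour v i) c

    routeCost : Fin n → List (Fin d) → ℕ
    routeCost v [] = 0
    routeCost v (i ∷ c) = stepCost v i + routeCost (neighbour v i) c

    follow-++ : ∀ v c q → follow v (c ++ q) ≡ follow (follow v c) q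
    follow-++ v [] q = refl
    follow-++ v (i ∷ c) q = follow-++ (neighbour v i) c q

    routeCost-++ : ∀ v c q → routeCost v (c ++ q) ≡ routeCost v c + routeCost (follow v c) q
    routeCost-++ v [] q = refl
    routeCost-++ v (i ∷ c) q =
      trans (cong (stepCost v i +_) (routeCost-++ (neighbour v i) c q)) (sym (ℕₚ.+-assoc (stepCost v i) _ _))

    routeCost≤2*length : ∀ v c → routeCost v c ≤ 2 * length c
    routeCost≤2*length v [] = z≤n
    routeCost≤2*length v (i ∷ c) = ℕₚ.≤-trans (ℕₚ.+-mono-≤ (stepCost≤2 v i) (routeCost≤2*length (neighbour v i) c))
                                              (ℕₚ.≤-reflexive (sym (ℕₚ.*-distribˡ-+ 2 1 (length c))))

    2*dM≤routeCost : ∀ v c → 2 * dM v (follow v c) ≤ routeCost v c × 2 * dM (follow v c) v ≤ routeCost v c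
    2*dM≤routeCost v [] rewrite dM-refl v = z≤n , z≤n
    2*dM≤routeCost v (i ∷ c) with 2*dM≤stepCost v i | 2*dM≤routeCost (neighbour v i) c
    ... | out₁ , back₁ | out₂ , back₂ =
      2*dM-triangle out₁ out₂ ,
      ℕₚ.≤-trans (2*dM-triangle back₂ back₁) (ℕₚ.≤-reflexive (ℕₚ.+-comm (routeCost (neighbour v i) c) (stepCost v i)))

    walk⇒route : ∀ {x y} (w : Walk G x y) → Σ (List (Fin d)) λ c → follow x c ≡ y × length c ≡ len G w
    walk⇒route here = [] , refl , refl
    walk⇒route (step a e w) with neighbour-surjective e | walk⇒route w
    ... | i , ≡a | c , follow≡ , length≡ = i ∷ c , trans (cong (λ z → follow z c) ≡a) follow≡ , cong suc length≡

module FinLemmas where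

  open import Data.Nat using (_*_; _+_)
  open import Data.Fin using (Fin; remQuot; combine; splitAt; join)
  import Data.Fin.Properties as Finₚ
  open import Data.Product using (uncurry)
  open import Relation.Binary.PropositionalEquality

  remQuot-injective : ∀ {m} k {i j : Fin (m * k)} → remQuot {m} k i ≡ remQuot k j → i ≡ j
  remQuot-injective {m} k {i} {j} eq =
    trans (sym (Finₚ.combine-remQuot {m} k i)) (trans (cong (uncurry combine) eq) (Finₚ.combine-remQuot {m} k j))

  splitAt-injective : ∀ m {n} {i j : Fin (m + n)} → splitAt m i ≡ splitAt m j → i ≡ j
  splitAt-injective m {n} {i} {j} eq =
    trans (sym (Finₚ.join-splitAt m n i)) (trans (cong (join m n) eq) (Finₚ.join-splitAt m n j))

-- Words of length at most L over Fin d, enumerated by Fin (wordCount L),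
-- shorter words first.
module WordCodes (d : ℕ) where

  open import Data.Nat as ℕ using (ℕ; zero; suc; _+_; _*_; _^_; _≤_; _<_; z≤n)
  import Data.Nat.Properties as ℕₚ
  open import Data.Fin as Fin using (Fin; splitAt; _↑ˡ_; _↑ʳ_; combine; remQuot; toℕ)
  import Data.Fin.Properties as Finₚ
  open import Data.List using (List; []; _∷_; length)
  import Data.List.Properties as Listₚ
  open import Data.Product using (_,_; proj₁; proj₂)
  open import Data.Product.Properties using (×-≡,≡→≡)
  open import Data.Sum using (inj₁; inj₂; [_,_]′)
  open import Data.Empty using (⊥; ⊥-elim)
  open import Relation.Nullary using (yes; no)
  open import Relation.Binary.PropositionalEquality
  open import Function using (_∘_)
  open FinLemmas

  wordCount : ℕ → ℕ
  wordCount zero = 1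
  wordCount (suc L) = wordCount L + d ^ suc L

  decodeWord : ∀ j → Fin (d ^ j) → List (Fin d)
  decodeWord zero _ = []
  decodeWord (suc j) x = proj₁ (remQuot {d} (d ^ j) x) ∷ decodeWord j (proj₂ (remQuot {d} (d ^ j) x))

  encodeWord : (c : List (Fin d)) → Fin (d ^ length c)
  encodeWord [] = Fin.zero
  encodeWord (a ∷ c) = combine a (encodeWord c)

  decodeWord-encodeWord : ∀ c → decodeWord (length c) (encodeWord c) ≡ c
  decodeWord-encodeWord [] = refl
  decodeWord-encodeWord (a ∷ c) =
    cong₂ _∷_ (cong proj₁ split≡) (trans (cong (decodeWord (length c) ∘ proj₂) split≡) (decodeWord-encodeWord c))
    where
    split≡ = Finₚ.remQuot-combine {d} {d ^ length c} a (encodeWord c)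

  decodeWord-cast : ∀ c {j} (eq : length c ≡ j) → decodeWord j (subst (Fin ∘ (d ^_)) eq (encodeWord c)) ≡ c
  decodeWord-cast c refl = decodeWord-encodeWord c

  length-decodeWord : ∀ j x → length (decodeWord j x) ≡ j
  length-decodeWord zero x = refl
  length-decodeWord (suc j) x = cong suc (length-decodeWord j _)

  decodeWord-injective : ∀ j x y → decodeWord j x ≡ decodeWord j y → x ≡ y
  decodeWord-injective zero Fin.zero Fin.zero _ = refl
  decodeWord-injective (suc j) x y eq with Listₚ.∷-injective eq
  ... | head≡ , tail≡ =
    remQuot-injective {d} (d ^ j) (×-≡,≡→≡ (head≡ , decodeWord-injective j _ _ tail≡))

  decode : ∀ L → Fin (wordCount L) → List (Fin d)
  decode zero _ = []
  decode (suc L) i = [ decode L , decodeWord (suc L) ]′ (splitAt (wordCount L) i)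

  encode : ∀ L → List (Fin d) → Fin (wordCount L)
  encode zero c = Fin.zero
  encode (suc L) c with length c ℕ.≟ suc L
  ... | yes ≡1+L = wordCount L ↑ʳ subst (Fin ∘ (d ^_)) ≡1+L (encodeWord c)
  ... | no _ = encode L c ↑ˡ (d ^ suc L)

  length-decode≤ : ∀ L i → length (decode L i) ≤ L
  length-decode≤ zero i = z≤n
  length-decode≤ (suc L) i with splitAt (wordCount L) i
  ... | inj₁ a = ℕₚ.m≤n⇒m≤1+n (length-decode≤ L a)
  ... | inj₂ b = ℕₚ.≤-reflexive (length-decodeWord (suc L) b)

  decode-encode : ∀ L c → length c ≤ L → decode L (encode L c) ≡ c
  decode-encode zero [] _ = refl
  decode-encode (suc L) c ≤L with length c ℕ.≟ suc L
  ... | yes ≡1+L rewrite Finₚ.splitAt-↑ʳ (wordCount L) (d ^ suc L) (subst (Fin ∘ (d ^_)) ≡1+L (encodeWord c)) =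
    decodeWord-cast c ≡1+L
  ... | no ≢ rewrite Finₚ.splitAt-↑ˡ (wordCount L) (encode L c) (d ^ suc L) =
    decode-encode L c (ℕₚ.≤-pred (ℕₚ.≤∧≢⇒< ≤L ≢))

  decode-injective : ∀ L x y → decode L x ≡ decode L y → x ≡ y
  decode-injective zero Fin.zero Fin.zero _ = refl
  decode-injective (suc L) x y eq = splitAt-injective (wordCount L) (split-injective _ _ eq)
    where
    short≢long : ∀ a b → decode L a ≡ decodeWord (suc L) b → ⊥
    short≢long a b eq =
      ℕₚ.<-irrefl refl (subst (_≤ L) (trans (cong length eq) (length-decodeWord (suc L) b)) (length-decode≤ L a))
    split-injective : ∀ p q → [ decode L , decodeWord (suc L) ]′ p ≡ [ decode L , decodeWord (suc L) ]′ q → p ≡ q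
    split-injective (inj₁ a) (inj₁ b) eq = cong inj₁ (decode-injective L a b eq)
    split-injective (inj₂ a) (inj₂ b) eq = cong inj₂ (decodeWord-injective (suc L) a b eq)
    split-injective (inj₁ a) (inj₂ b) eq = ⊥-elim (short≢long a b eq)
    split-injective (inj₂ a) (inj₁ b) eq = ⊥-elim (short≢long b a (sym eq))

  toℕ-encode-suc : ∀ L c → length c ≤ L → toℕ (encode (suc L) c) ≡ toℕ (encode L c)
  toℕ-encode-suc L c ≤L with length c ℕ.≟ suc L
  ... | yes ≡1+L = ⊥-elim (ℕₚ.<-irrefl refl (subst (_≤ L) ≡1+L ≤L))
  ... | no _ = Finₚ.toℕ-↑ˡ (encode L c) (d ^ suc L)

  toℕ-encode<wordCount : ∀ L t c → t ≤ L → length c ≤ t → toℕ (encode L c) < wordCount t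
  toℕ-encode<wordCount L t c t≤L ≤t with ℕₚ.m≤n⇒m<n∨m≡n t≤L
  ... | inj₂ refl = Finₚ.toℕ<n (encode L c)
  toℕ-encode<wordCount (suc L) t c t≤L ≤t | inj₁ t<1+L =
    subst (_< wordCount t) (sym (toℕ-encode-suc L c (ℕₚ.≤-trans ≤t (ℕₚ.≤-pred t<1+L))))
          (toℕ-encode<wordCount L t c (ℕₚ.≤-pred t<1+L) ≤t)

  d^L≤wordCount : ∀ L → d ^ L ≤ wordCount L
  d^L≤wordCount zero = ℕₚ.≤-refl
  d^L≤wordCount (suc L) = ℕₚ.m≤n+m (d ^ suc L) (wordCount L)

  wordCount<d^suc : 2 ≤ d → ∀ L → wordCount L < d ^ suc L
  wordCount<d^suc 2≤d zero = subst (1 <_) (sym (ℕₚ.*-identityʳ d)) 2≤d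
  wordCount<d^suc 2≤d (suc L) = begin-strict
    wordCount L + d ^ suc L   <⟨ ℕₚ.+-monoˡ-< (d ^ suc L) (wordCount<d^suc 2≤d L) ⟩
    d ^ suc L + d ^ suc L     ≡⟨ cong (d ^ suc L +_) (sym (ℕₚ.+-identityʳ (d ^ suc L))) ⟩
    2 * d ^ suc L             ≤⟨ ℕₚ.*-monoˡ-≤ (d ^ suc L) 2≤d ⟩
    d ^ suc (suc L)           ∎
    where open ℕₚ.≤-Reasoning

module ParentEdgesAcyclic {m : ℕ} (H : Graph m) (parent : Fin m → Fin m) (depth : Fin m → ℕ) where

  open import Data.Nat using (ℕ; suc; _+_; s≤s)
  import Data.Nat.Properties as ℕₚ
  open import Data.Bool using (T)
  open import Data.List using (List; []; _∷_; _++_; [_])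
  import Data.List.Properties as Listₚ
  open import Data.List.Membership.Propositional using (_∈_)
  import Data.List.Membership.Propositional.Properties as ∈ₚ
  open import Data.List.Relation.Unary.Any using (here; there)
  open import Data.List.Relation.Unary.All as All using ([]; _∷_)
  open import Data.List.Relation.Unary.AllPairs using ([]; _∷_)
  open import Data.List.Relation.Unary.Unique.Propositional using (Unique)
  open import Data.List.Relation.Unary.Unique.Propositional.Properties using (++⁺; Unique[x∷xs]⇒x∉xs)
  open import Data.Product using (∃; _×_; _,_; proj₁; proj₂)
  open import Data.Sum using (_⊎_; inj₁; inj₂)
  open import Data.Unit using (⊤; tt)
  open import Data.Empty using (⊥; ⊥-elim)
  open import Relation.Nullary using (¬_)
  open import Relation.Binary.PropositionalEquality hiding ([_])

  ParentStep : Fin m → Fin m → Set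
  ParentStep u v = v ≡ parent u × depth u ≡ suc (depth v)

  module _ (edge-parent : ∀ u v → T (adj H u v) → ParentStep u v ⊎ ParentStep v u) where

    NonBacktracking : ∀ {a b} → Walk H a b → Set
    NonBacktracking here = ⊤
    NonBacktracking (step v e here) = ⊤
    NonBacktracking (step {u} v e (step x e′ r)) = ¬ u ≡ x × NonBacktracking (step x e′ r)

    Ascending : ∀ {a b} → Walk H a b → Set
    Ascending here = ⊤
    Ascending (step {u} v e r) = ParentStep u v × Ascending r

    EndsDescending : ∀ {a b} → Walk H a b → Set
    EndsDescending {a} {b} w = ∃ λ xs → inner H w ≡ xs ++ [ parent b ]

    depth-ascending : ∀ {a b} (w : Walk H a b) → Ascending w → depth a ≡ depth b + len H w
    depth-ascending here _ = sym (ℕₚ.+-identityʳ _)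
    depth-ascending (step v e r) ((_ , depth≡) , asc) =
      trans depth≡ (trans (cong suc (depth-ascending r asc)) (sym (ℕₚ.+-suc _ (len H r))))

    -- Once a non-backtracking walk steps down it can never step up again.
    ascending-or-endsDescending : ∀ {a b} (w : Walk H a b) → NonBacktracking w → Ascending w ⊎ EndsDescending w
    ascending-or-endsDescending here _ = inj₁ tt
    ascending-or-endsDescending (step {u} v e here) _ with edge-parent u v e
    ... | inj₁ up = inj₁ (up , tt)
    ... | inj₂ (u≡ , _) = inj₂ ([] , cong [_] u≡)
    ascending-or-endsDescending (step {u} v e (step x e′ r)) (u≢x , nb) with ascending-or-endsDescending (step x e′ r) nb
    ... | inj₂ (xs , ends) = inj₂ (u ∷ xs , cong (u ∷_) ends)
    ... | inj₁ asc with edge-parent u v e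
    ...   | inj₁ up = inj₁ (up , asc)
    ...   | inj₂ (u≡ , _) = ⊥-elim (u≢x (trans u≡ (sym (proj₁ (proj₁ asc)))))

    depth-descending : ∀ {a v b} (e : T (adj H a v)) (r : Walk H v b) → NonBacktracking (step v e r) →
                       ParentStep v a → depth b ≡ depth a + suc (len H r)
    depth-descending e here _ (_ , depth≡) = trans depth≡ (ℕₚ.+-comm 1 _)
    depth-descending {a} {v} e (step x e′ r) (a≢x , nb) (a≡ , depth≡) with edge-parent v x e′
    ... | inj₁ (x≡ , _) = ⊥-elim (a≢x (trans a≡ (sym x≡)))
    ... | inj₂ down = trans (depth-descending e′ r nb down)
                            (trans (cong (_+ suc (len H r)) depth≡) (sym (ℕₚ.+-suc (depth a) (suc (len H r)))))

    head∈ : ∀ {x b} (r : Walk H x b) → x ∈ inner H r ++ [ b ]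
    head∈ here = here refl
    head∈ (step _ _ _) = here refl

    unique⇒nonBacktracking : ∀ {a b} (w : Walk H a b) → Unique (inner H w ++ [ b ]) → NonBacktracking w
    unique⇒nonBacktracking here _ = tt
    unique⇒nonBacktracking (step v e here) _ = tt
    unique⇒nonBacktracking (step x e (step y e′ r)) (x∉ ∷ unique) =
      (λ x≡ → All.lookup x∉ (there (head∈ r)) x≡) , unique⇒nonBacktracking (step y e′ r) unique

    rotate-unique : ∀ {x} {xs : List (Fin m)} → Unique (x ∷ xs) → Unique (xs ++ [ x ])
    rotate-unique u@(_ ∷ unique) = ++⁺ unique ([] ∷ []) λ { (x∈ , here refl) → Unique[x∷xs]⇒x∉xs u x∈ }

    -- A cycle leaving u downwards keeps descending and cannot close up; one leaving
    -- upwards to v₁ = parent u must come back down from parent u = v₁, repeating v₁.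
    acyclic : Acyclic H
    acyclic u here (() , _)
    acyclic u (step v₁ e here) (s≤s () , _)
    acyclic u (step v₁ e (step v₂ e₂ here)) (s≤s (s≤s ()) , _)
    acyclic u (step v₁ e rest@(step v₂ e₂ (step v₃ e₃ r))) (_ , unique@(u∉ ∷ v₁∉ ∷ _)) with edge-parent u v₁ e
    ... | inj₂ down = ℕₚ.m≢1+m+n (depth u) (trans (depth-descending e rest (u≢v₂ , nb) down) (ℕₚ.+-suc (depth u) _))
      where
      nb = unique⇒nonBacktracking rest (rotate-unique unique)
      u≢v₂ = All.lookup u∉ (there (here refl))
    ... | inj₁ (v₁≡ , depth≡) with ascending-or-endsDescending rest (unique⇒nonBacktracking rest (rotate-unique unique))
    ...   | inj₁ asc = ℕₚ.m≢1+m+n (depth u) (trans depth≡ (cong suc (depth-ascending rest asc)))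
    ...   | inj₂ (xs , ends) = v₁-repeated xs ends
      where
      v₁-repeated : ∀ xs → v₁ ∷ v₂ ∷ inner H r ≡ xs ++ [ parent u ] → ⊥
      v₁-repeated (y ∷ ys) eq = All.lookup v₁∉ (subst (_∈ v₂ ∷ inner H r) (sym v₁≡) parent∈) refl
        where
        parent∈ : parent u ∈ v₂ ∷ inner H r
        parent∈ = subst (parent u ∈_) (sym (proj₂ (Listₚ.∷-injective eq))) (∈ₚ.∈-++⁺ʳ ys (here refl))

-- node r c stands for the vertex follow r c.  In half units, the edge from a
-- root to the hub weighs Δ and the edge from node r (c ++ [ i ]) to its parent
-- weighs stepCost (follow r c) i.
module WordTree {n : ℕ} (G : Graph n) (dM : Fin n → Fin n → ℕ) (sp : IsShortestPathMetric G dM)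
                (d : ℕ) (degree≤d : ∀ u → degree G u ≤ d) (Δ L : ℕ) where

  open import Data.Nat using (ℕ; suc; _+_; _*_; _≤_; z≤n)
  import Data.Nat.Properties as ℕₚ
  open import Data.Fin as Fin using (Fin; combine; remQuot)
  import Data.Fin.Properties as Finₚ
  open import Data.Bool using (Bool; true; false; T; _∧_; _∨_; if_then_else_)
  import Data.Bool.Properties as Boolₚ
  open import Data.List using (List; []; _∷_; _++_; length; [_])
  import Data.List.Properties as Listₚ
  open import Data.Product using (_×_; _,_; proj₁; proj₂)
  open import Data.Product.Properties using (×-≡,≡→≡)
  open import Data.Sum using (_⊎_; inj₁; inj₂)
  open import Data.Unit using (⊤; tt)
  open import Data.Empty using (⊥-elim)
  open import Function using (Equivalence; _∘_)
  open import Relation.Nullary using (¬_; yes; no; Dec)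
  open import Relation.Nullary.Decidable using (isYes; fromWitness; toWitness)
  open import Relation.Binary.PropositionalEquality hiding ([_])
  open import Data.Rational as ℚ using (ℚ)
  open import Data.Nat.Solver using (module +-*-Solver)
  open +-*-Solver using (solve; _:+_; _:=_)
  open HalfUnits
  open FinLemmas
  open ShortestPaths G dM sp
  open Routes d degree≤d
  open WordCodes d

  data Node : Set where
    hub : Node
    node : Fin n → List (Fin d) → Node

  node-injective : ∀ {r r′ c c′} → node r c ≡ node r′ c′ → r ≡ r′ × c ≡ c′
  node-injective refl = refl , refl

  _≟ᴺ_ : (x y : Node) → Dec (x ≡ y)
  hub ≟ᴺ hub = yes refl
  hub ≟ᴺ node _ _ = no λ ()
  node _ _ ≟ᴺ hub = no λ ()
  node r c ≟ᴺ node r′ c′ with r Fin.≟ r′ | Listₚ.≡-dec Fin._≟_ c c′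
  ... | yes refl | yes refl = yes refl
  ... | no r≢ | _ = no λ eq → r≢ (proj₁ (node-injective eq))
  ... | _ | no c≢ = no λ eq → c≢ (proj₂ (node-injective eq))

  init⁺ : Fin d → List (Fin d) → List (Fin d)
  init⁺ a [] = []
  init⁺ a (b ∷ c) = a ∷ init⁺ b c

  last⁺ : Fin d → List (Fin d) → Fin d
  last⁺ a [] = a
  last⁺ a (b ∷ c) = last⁺ b c

  init⁺-++-last⁺ : ∀ a c → a ∷ c ≡ init⁺ a c ++ [ last⁺ a c ]
  init⁺-++-last⁺ a [] = refl
  init⁺-++-last⁺ a (b ∷ c) = cong (a ∷_) (init⁺-++-last⁺ b c)

  init⁺-snoc : ∀ a c i → init⁺ a (c ++ [ i ]) ≡ a ∷ c
  init⁺-snoc a [] i = refl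
  init⁺-snoc a (b ∷ c) i = cong (a ∷_) (init⁺-snoc b c i)

  last⁺-snoc : ∀ a c i → last⁺ a (c ++ [ i ]) ≡ i
  last⁺-snoc a [] i = refl
  last⁺-snoc a (b ∷ c) i = last⁺-snoc b c i

  length-init⁺ : ∀ a c → length (init⁺ a c) ≡ length c
  length-init⁺ a [] = refl
  length-init⁺ a (b ∷ c) = cong suc (length-init⁺ b c)

  parentNode : Node → Node
  parentNode hub = hub
  parentNode (node r []) = hub
  parentNode (node r (a ∷ c)) = node r (init⁺ a c)

  parentWeight : Node → ℕ
  parentWeight hub = 0
  parentWeight (node r []) = Δ
  parentWeight (node r (a ∷ c)) = stepCost (follow r (init⁺ a c)) (last⁺ a c)

  level : Node → ℕ
  level hub = 0
  level (node r c) = suc (length c)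

  nonHub : Node → Bool
  nonHub hub = false
  nonHub (node _ _) = true

  level-parentNode : ∀ x → T (nonHub x) → level x ≡ suc (level (parentNode x))
  level-parentNode (node r []) _ = refl
  level-parentNode (node r (a ∷ c)) _ = cong suc (cong suc (sym (length-init⁺ a c)))

  parentNode≢ : ∀ x → T (nonHub x) → ¬ x ≡ parentNode x
  parentNode≢ x nh x≡ = ℕₚ.1+n≢n (trans (cong (suc ∘ level) x≡) (sym (level-parentNode x nh)))

  isParentOf : Node → Node → Bool
  isParentOf p x = nonHub x ∧ isYes (p ≟ᴺ parentNode x)

  isParentOf⇒ : ∀ p x → T (isParentOf p x) → p ≡ parentNode x × T (nonHub x)
  isParentOf⇒ p x t with Equivalence.to (Boolₚ.T-∧ {nonHub x}) t
  ... | nh , p≡ = toWitness {a? = p ≟ᴺ parentNode x} p≡ , nh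

  isParentOf-parentNode : ∀ x → T (nonHub x) → T (isParentOf (parentNode x) x)
  isParentOf-parentNode x nh = Equivalence.from (Boolₚ.T-∧ {nonHub x}) (nh , fromWitness {a? = parentNode x ≟ᴺ parentNode x} refl)

  ¬isParentOf-parentNode : ∀ x → T (nonHub x) → isParentOf x (parentNode x) ≡ false
  ¬isParentOf-parentNode x nh with nonHub (parentNode x) in nonHub≡ | x ≟ᴺ parentNode (parentNode x)
  ... | false | _ = refl
  ... | true | no _ = refl
  ... | true | yes x≡ = ⊥-elim (ℕₚ.m≢1+m+n (level x) (begin
    level x                                   ≡⟨ level-parentNode x nh ⟩
    suc (level (parentNode x))                ≡⟨ cong suc (level-parentNode (parentNode x) (subst T (sym nonHub≡) tt)) ⟩
    suc (suc (level (parentNode (parentNode x)))) ≡⟨ cong (suc ∘ suc ∘ level) x≡ ⟨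
    suc (suc (level x))                       ≡⟨ cong suc (ℕₚ.+-comm 1 (level x)) ⟩
    suc (level x + 1)                         ∎))
    where open ≡-Reasoning

  isTreeEdge : Node → Node → Bool
  isTreeEdge x y = isParentOf x y ∨ isParentOf y x

  weightIf : Bool → ℕ → ℕ
  weightIf b w = if b then w else 0

  weightIf-true : ∀ {b w} → T b → weightIf b w ≡ w
  weightIf-true {true} _ = refl

  edgeWeight : Node → Node → ℕ
  edgeWeight x y = weightIf (isParentOf x y) (parentWeight y) + weightIf (isParentOf y x) (parentWeight x)

  edgeWeight-sym : ∀ x y → edgeWeight x y ≡ edgeWeight y x
  edgeWeight-sym x y = ℕₚ.+-comm (weightIf (isParentOf x y) (parentWeight y)) _

  edgeWeight-parentNode : ∀ x → T (nonHub x) → edgeWeight x (parentNode x) ≡ parentWeight x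
  edgeWeight-parentNode x nh rewrite ¬isParentOf-parentNode x nh = weightIf-true (isParentOf-parentNode x nh)

  treeEdge⇒parent : ∀ x y → T (isTreeEdge x y) → (x ≡ parentNode y × T (nonHub y)) ⊎ (y ≡ parentNode x × T (nonHub x))
  treeEdge⇒parent x y e with Equivalence.to (Boolₚ.T-∨ {isParentOf x y}) e
  ... | inj₁ x-parent = inj₁ (isParentOf⇒ x y x-parent)
  ... | inj₂ y-parent = inj₂ (isParentOf⇒ y x y-parent)

  parent⇒treeEdge : ∀ x → T (nonHub x) → T (isTreeEdge (parentNode x) x)
  parent⇒treeEdge x nh = Equivalence.from (Boolₚ.T-∨ {isParentOf (parentNode x) x}) (inj₁ (isParentOf-parentNode x nh))

  isTreeEdge-irrefl : ∀ x → isTreeEdge x x ≡ false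
  isTreeEdge-irrefl hub = refl
  isTreeEdge-irrefl x@(node r c) with x ≟ᴺ parentNode x
  ... | yes x≡ = ⊥-elim (parentNode≢ x tt x≡)
  ... | no _ = refl

  Shallow : Node → Set
  Shallow hub = ⊤
  Shallow (node r c) = length c ≤ L

  nodeCount : ℕ
  nodeCount = suc (n * wordCount L)

  decodeNode : Fin nodeCount → Node
  decodeNode Fin.zero = hub
  decodeNode (Fin.suc i) = node (proj₁ (remQuot {n} (wordCount L) i)) (decode L (proj₂ (remQuot {n} (wordCount L) i)))

  encodeNode : Node → Fin nodeCount
  encodeNode hub = Fin.zero
  encodeNode (node r c) = Fin.suc (combine r (encode L c))

  decodeNode-encodeNode : ∀ x → Shallow x → decodeNode (encodeNode x) ≡ x
  decodeNode-encodeNode hub _ = refl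
  decodeNode-encodeNode (node r c) ≤L =
    cong₂ node (cong proj₁ split≡) (trans (cong (decode L ∘ proj₂) split≡) (decode-encode L c ≤L))
    where split≡ = Finₚ.remQuot-combine r (encode L c)

  decodeNode-shallow : ∀ u → Shallow (decodeNode u)
  decodeNode-shallow Fin.zero = tt
  decodeNode-shallow (Fin.suc i) = length-decode≤ L _

  decodeNode-injective : ∀ u v → decodeNode u ≡ decodeNode v → u ≡ v
  decodeNode-injective Fin.zero Fin.zero _ = refl
  decodeNode-injective (Fin.suc i) (Fin.suc j) eq with node-injective eq
  ... | r≡ , c≡ = cong Fin.suc (remQuot-injective {n} (wordCount L) (×-≡,≡→≡ (r≡ , decode-injective L _ _ c≡)))

  encodeNode-decodeNode : ∀ u → encodeNode (decodeNode u) ≡ u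
  encodeNode-decodeNode u = decodeNode-injective _ _ (decodeNode-encodeNode (decodeNode u) (decodeNode-shallow u))

  treeGraph : Graph nodeCount
  treeGraph = record
    { adj = λ u v → isTreeEdge (decodeNode u) (decodeNode v)
    ; sym = λ u v → Boolₚ.∨-comm (isParentOf (decodeNode u) (decodeNode v)) _
    ; irrefl = λ u → isTreeEdge-irrefl (decodeNode u) }

  open ParentEdgesAcyclic treeGraph (encodeNode ∘ parentNode ∘ decodeNode) (level ∘ decodeNode)

  parentNode⇒parentStep : ∀ u v → decodeNode v ≡ parentNode (decodeNode u) → T (nonHub (decodeNode u)) → ParentStep u v
  parentNode⇒parentStep u v v≡ nh =
    trans (sym (encodeNode-decodeNode v)) (cong encodeNode v≡) ,
    trans (level-parentNode (decodeNode u) nh) (cong (suc ∘ level) (sym v≡))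

  treeEdge-parentStep : ∀ u v → T (adj treeGraph u v) → ParentStep u v ⊎ ParentStep v u
  treeEdge-parentStep u v e with treeEdge⇒parent (decodeNode u) (decodeNode v) e
  ... | inj₁ (u≡ , nh) = inj₂ (parentNode⇒parentStep v u u≡ nh)
  ... | inj₂ (v≡ , nh) = inj₁ (parentNode⇒parentStep u v v≡ nh)

  -- sameRootDist v c c′: distance between the nodes reached by the words c and
  -- c′ from a common node that stands for vertex v.
  sameRootDist : Fin n → List (Fin d) → List (Fin d) → ℕ
  sameRootDist v [] c′ = routeCost v c′
  sameRootDist v (i ∷ c) [] = routeCost v (i ∷ c)
  sameRootDist v (i ∷ c) (j ∷ c′) with i Fin.≟ j
  ... | yes _ = sameRootDist (neighbour v i) c c′
  ... | no _ = routeCost v (i ∷ c) + routeCost v (j ∷ c′)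

  treeDist : Node → Node → ℕ
  treeDist hub hub = 0
  treeDist hub (node r c) = Δ + routeCost r c
  treeDist (node r c) hub = routeCost r c + Δ
  treeDist (node r c) (node r′ c′) with r Fin.≟ r′
  ... | yes _ = sameRootDist r c c′
  ... | no _ = routeCost r c + (Δ + Δ + routeCost r′ c′)

  sameRootDist-refl : ∀ v c → sameRootDist v c c ≡ 0
  sameRootDist-refl v [] = refl
  sameRootDist-refl v (i ∷ c) with i Fin.≟ i
  ... | yes _ = sameRootDist-refl (neighbour v i) c
  ... | no i≢i = ⊥-elim (i≢i refl)

  treeDist-refl : ∀ x → treeDist x x ≡ 0
  treeDist-refl hub = refl
  treeDist-refl (node r c) with r Fin.≟ r
  ... | yes _ = sameRootDist-refl r c
  ... | no r≢r = ⊥-elim (r≢r refl)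

  sameRootDist-++ : ∀ v c q → sameRootDist v c (c ++ q) ≡ routeCost (follow v c) q
  sameRootDist-++ v [] q = refl
  sameRootDist-++ v (i ∷ c) q with i Fin.≟ i
  ... | yes _ = sameRootDist-++ (neighbour v i) c q
  ... | no i≢i = ⊥-elim (i≢i refl)

  treeDist-++ : ∀ r c q → treeDist (node r c) (node r (c ++ q)) ≡ routeCost (follow r c) q
  treeDist-++ r c q with r Fin.≟ r
  ... | yes _ = sameRootDist-++ r c q
  ... | no r≢r = ⊥-elim (r≢r refl)

  sameRootDist-[] : ∀ v c → sameRootDist v c [] ≡ routeCost v c
  sameRootDist-[] v [] = refl
  sameRootDist-[] v (i ∷ c) = refl

  treeDist-root≤ : ∀ r c y → treeDist (node r c) (node y []) ≤ 2 * length c + (Δ + Δ)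
  treeDist-root≤ r c y with r Fin.≟ y
  ... | yes refl = ℕₚ.≤-trans (ℕₚ.≤-reflexive (sameRootDist-[] r c)) (ℕₚ.≤-trans (routeCost≤2*length r c) (ℕₚ.m≤m+n _ _))
  ... | no _ = ℕₚ.+-mono-≤ (routeCost≤2*length r c) (ℕₚ.≤-reflexive (ℕₚ.+-identityʳ (Δ + Δ)))

  routeCost-snoc : ∀ v c i → routeCost v (c ++ [ i ]) ≡ routeCost v c + stepCost (follow v c) i
  routeCost-snoc v c i = trans (routeCost-++ v c [ i ]) (cong (routeCost v c +_) (ℕₚ.+-identityʳ _))

  routeCost-snoc-+ : ∀ r c i K → routeCost r (c ++ [ i ]) + K ≤ stepCost (follow r c) i + (routeCost r c + K)
                              × routeCost r c + K ≤ stepCost (follow r c) i + (routeCost r (c ++ [ i ]) + K)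
  routeCost-snoc-+ r c i K rewrite routeCost-snoc r c i =
    ℕₚ.≤-reflexive (solve 3 (λ A w K → A :+ w :+ K := w :+ (A :+ K)) refl (routeCost r c) (stepCost (follow r c) i) K) ,
    ℕₚ.≤-trans (ℕₚ.+-monoˡ-≤ K (ℕₚ.m≤m+n _ _)) (ℕₚ.m≤n+m _ (stepCost (follow r c) i))

  sameRootDist-snoc : ∀ v c i c′ → sameRootDist v (c ++ [ i ]) c′ ≤ stepCost (follow v c) i + sameRootDist v c c′
                                 × sameRootDist v c c′ ≤ stepCost (follow v c) i + sameRootDist v (c ++ [ i ]) c′
  sameRootDist-snoc v [] i [] = ℕₚ.≤-refl , z≤n
  sameRootDist-snoc v [] i (j ∷ c′) with i Fin.≟ j
  ... | yes refl = ℕₚ.≤-trans (ℕₚ.m≤n+m _ (stepCost v i)) (ℕₚ.+-monoʳ-≤ (stepCost v i) (ℕₚ.m≤n+m _ (stepCost v i))) ,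
                   ℕₚ.≤-refl
  ... | no _ = ℕₚ.≤-reflexive (cong (_+ routeCost v (j ∷ c′)) (ℕₚ.+-identityʳ (stepCost v i))) ,
               ℕₚ.≤-trans (ℕₚ.m≤n+m _ (stepCost v i + 0)) (ℕₚ.m≤n+m _ (stepCost v i))
  sameRootDist-snoc v (k ∷ c) i [] =
    ℕₚ.≤-reflexive (trans (routeCost-snoc v (k ∷ c) i) (ℕₚ.+-comm (routeCost v (k ∷ c)) _)) ,
    ℕₚ.≤-trans (ℕₚ.≤-trans (ℕₚ.m≤m+n _ _) (ℕₚ.≤-reflexive (sym (routeCost-snoc v (k ∷ c) i)))) (ℕₚ.m≤n+m _ (stepCost (follow v (k ∷ c)) i))
  sameRootDist-snoc v (k ∷ c) i (j ∷ c′) with k Fin.≟ j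
  ... | yes refl = sameRootDist-snoc (neighbour v k) c i c′
  ... | no _ = routeCost-snoc-+ v (k ∷ c) i (routeCost v (j ∷ c′))

  treeDist-snoc : ∀ r c i y → treeDist (node r (c ++ [ i ])) y ≤ stepCost (follow r c) i + treeDist (node r c) y
                            × treeDist (node r c) y ≤ stepCost (follow r c) i + treeDist (node r (c ++ [ i ])) y
  treeDist-snoc r c i hub = routeCost-snoc-+ r c i Δ
  treeDist-snoc r c i (node r′ c′) with r Fin.≟ r′
  ... | yes refl = sameRootDist-snoc r c i c′
  ... | no _ = routeCost-snoc-+ r c i (Δ + Δ + routeCost r′ c′)

  treeDist-parentNode : ∀ x y → T (nonHub x) → treeDist x y ≤ parentWeight x + treeDist (parentNode x) y
                                              × treeDist (parentNode x) y ≤ parentWeight x + treeDist x y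
  treeDist-parentNode (node r []) hub _ = ℕₚ.≤-reflexive (ℕₚ.+-comm 0 Δ) , z≤n
  treeDist-parentNode (node r []) (node r′ c′) _ with r Fin.≟ r′
  ... | yes refl = ℕₚ.≤-trans (ℕₚ.m≤n+m _ Δ) (ℕₚ.+-monoʳ-≤ Δ (ℕₚ.m≤n+m _ Δ)) , ℕₚ.≤-refl
  ... | no _ = ℕₚ.≤-reflexive (ℕₚ.+-assoc Δ Δ _) , ℕₚ.+-monoʳ-≤ Δ (ℕₚ.m≤n+m (routeCost r′ c′) (Δ + Δ))
  treeDist-parentNode (node r (a ∷ c)) y _ =
    subst (λ z → treeDist (node r z) y ≤ parentWeight (node r (a ∷ c)) + treeDist (node r (init⁺ a c)) y
               × treeDist (node r (init⁺ a c)) y ≤ parentWeight (node r (a ∷ c)) + treeDist (node r z) y)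
          (sym (init⁺-++-last⁺ a c)) (treeDist-snoc r (init⁺ a c) (last⁺ a c) y)

  -- treeDist changes by at most the weight across every edge, so it bounds the
  -- weight of every walk from below; treeDistᵂ below shows that it is attained.
  treeDist-edge : ∀ x z y → T (isTreeEdge x z) → treeDist x y ≤ edgeWeight x z + treeDist z y
  treeDist-edge x z y e with treeEdge⇒parent x z e
  ... | inj₁ (refl , nh) rewrite edgeWeight-sym (parentNode z) z | edgeWeight-parentNode z nh = proj₂ (treeDist-parentNode z y nh)
  ... | inj₂ (refl , nh) rewrite edgeWeight-parentNode x nh = proj₁ (treeDist-parentNode x y nh)

  treeWeight : Fin nodeCount → Fin nodeCount → ℕ
  treeWeight u v = edgeWeight (decodeNode u) (decodeNode v)

  treeWeight-sym : ∀ u v → treeWeight u v ≡ treeWeight v u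
  treeWeight-sym u v = edgeWeight-sym (decodeNode u) (decodeNode v)

  open Walks treeGraph
  open Weighted treeWeight

  treeDist≤weight : ∀ {a b} (w : Walk treeGraph a b) → treeDist (decodeNode a) (decodeNode b) ≤ weight w
  treeDist≤weight {a} here = ℕₚ.≤-reflexive (treeDist-refl (decodeNode a))
  treeDist≤weight {a} {b} (step z e w) =
    ℕₚ.≤-trans (treeDist-edge (decodeNode a) (decodeNode z) (decodeNode b) e) (ℕₚ.+-monoʳ-≤ (treeWeight a z) (treeDist≤weight w))

  parentNode-snoc : ∀ r c i → parentNode (node r (c ++ [ i ])) ≡ node r c
  parentNode-snoc r [] i = refl
  parentNode-snoc r (a ∷ c) i = cong (node r) (init⁺-snoc a c i)

  parentWeight-snoc : ∀ r c i → parentWeight (node r (c ++ [ i ])) ≡ stepCost (follow r c) i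
  parentWeight-snoc r [] i = refl
  parentWeight-snoc r (a ∷ c) i rewrite init⁺-snoc a c i | last⁺-snoc a c i = refl

  edgeWeight-snoc : ∀ r c i → edgeWeight (node r c) (node r (c ++ [ i ])) ≡ stepCost (follow r c) i
  edgeWeight-snoc r c i = begin
    edgeWeight (node r c) (node r (c ++ [ i ]))                         ≡⟨ edgeWeight-sym (node r c) (node r (c ++ [ i ])) ⟩
    edgeWeight (node r (c ++ [ i ])) (node r c)                         ≡⟨ cong (edgeWeight (node r (c ++ [ i ]))) (parentNode-snoc r c i) ⟨
    edgeWeight (node r (c ++ [ i ])) (parentNode (node r (c ++ [ i ]))) ≡⟨ edgeWeight-parentNode (node r (c ++ [ i ])) tt ⟩
    parentWeight (node r (c ++ [ i ]))                                  ≡⟨ parentWeight-snoc r c i ⟩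
    stepCost (follow r c) i                                             ∎
    where open ≡-Reasoning

  edgeᴺ : ∀ x y → Shallow x → Shallow y → T (isTreeEdge x y) → WalkOfWeight (encodeNode x) (encodeNode y) (edgeWeight x y)
  edgeᴺ x y sx sy e = castᵂ refl refl (cong₂ edgeWeight (decodeNode-encodeNode x sx) (decodeNode-encodeNode y sy))
    (edgeᵂ (subst₂ (λ a b → T (isTreeEdge a b)) (sym (decodeNode-encodeNode x sx)) (sym (decodeNode-encodeNode y sy)) e))

  length-++-≤ : ∀ (p q : List (Fin d)) → length (p ++ q) ≤ L → length p ≤ L
  length-++-≤ p q ≤L = ℕₚ.≤-trans (ℕₚ.≤-trans (ℕₚ.m≤m+n _ _) (ℕₚ.≤-reflexive (sym (Listₚ.length-++ p)))) ≤L

  childᵂ : ∀ r c i → length (c ++ [ i ]) ≤ L →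
           WalkOfWeight (encodeNode (node r c)) (encodeNode (node r (c ++ [ i ]))) (stepCost (follow r c) i)
  childᵂ r c i ≤L = castᵂ refl refl (edgeWeight-snoc r c i)
    (edgeᴺ (node r c) (node r (c ++ [ i ])) (length-++-≤ c [ i ] ≤L) ≤L
      (subst (λ p → T (isTreeEdge p (node r (c ++ [ i ])))) (parentNode-snoc r c i) (parent⇒treeEdge (node r (c ++ [ i ])) tt)))

  downᵂ : ∀ r p q → length (p ++ q) ≤ L → WalkOfWeight (encodeNode (node r p)) (encodeNode (node r (p ++ q))) (routeCost (follow r p) q)
  downᵂ r p [] ≤L = castᵂ refl (cong (encodeNode ∘ node r) (sym (Listₚ.++-identityʳ p))) refl emptyᵂ
  downᵂ r p (i ∷ q) ≤L =
    castᵂ refl (cong (encodeNode ∘ node r) (Listₚ.++-assoc p [ i ] q)) (cong (λ z → stepCost (follow r p) i + routeCost z q) (follow-++ r p [ i ]))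
      (childᵂ r p i (length-++-≤ (p ++ [ i ]) q ≤L′) ++ᵂ downᵂ r (p ++ [ i ]) q ≤L′)
    where
    ≤L′ : length ((p ++ [ i ]) ++ q) ≤ L
    ≤L′ = subst (λ z → length z ≤ L) (sym (Listₚ.++-assoc p [ i ] q)) ≤L

  upᵂ : ∀ r p q → length (p ++ q) ≤ L → WalkOfWeight (encodeNode (node r (p ++ q))) (encodeNode (node r p)) (routeCost (follow r p) q)
  upᵂ r p q ≤L = reverseᵂ treeWeight-sym (downᵂ r p q ≤L)

  sameRootᵂ : ∀ r p c c′ → length (p ++ c) ≤ L → length (p ++ c′) ≤ L →
              WalkOfWeight (encodeNode (node r (p ++ c))) (encodeNode (node r (p ++ c′))) (sameRootDist (follow r p) c c′)
  sameRootᵂ r p [] c′ _ ≤L′ = castᵂ (cong (encodeNode ∘ node r) (sym (Listₚ.++-identityʳ p))) refl refl (downᵂ r p c′ ≤L′)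
  sameRootᵂ r p (i ∷ c) [] ≤L _ = castᵂ refl (cong (encodeNode ∘ node r) (sym (Listₚ.++-identityʳ p))) refl (upᵂ r p (i ∷ c) ≤L)
  sameRootᵂ r p (i ∷ c) (j ∷ c′) ≤L ≤L′ with i Fin.≟ j
  ... | yes refl =
    castᵂ (cong (encodeNode ∘ node r) (Listₚ.++-assoc p [ i ] c)) (cong (encodeNode ∘ node r) (Listₚ.++-assoc p [ i ] c′))
          (cong (λ z → sameRootDist z c c′) (follow-++ r p [ i ]))
          (sameRootᵂ r (p ++ [ i ]) c c′ (subst (λ z → length z ≤ L) (sym (Listₚ.++-assoc p [ i ] c)) ≤L)
                                         (subst (λ z → length z ≤ L) (sym (Listₚ.++-assoc p [ i ] c′)) ≤L′))
  ... | no _ = upᵂ r p (i ∷ c) ≤L ++ᵂ downᵂ r p (j ∷ c′) ≤L′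

  hubᵂ : ∀ r c → length c ≤ L → WalkOfWeight (encodeNode hub) (encodeNode (node r c)) (Δ + routeCost r c)
  hubᵂ r c ≤L = castᵂ refl refl (edgeWeight-sym hub (node r []))
                  (edgeᴺ hub (node r []) tt z≤n (parent⇒treeEdge (node r []) tt))
                ++ᵂ downᵂ r [] c ≤L

  treeDistᵂ : ∀ x y → Shallow x → Shallow y → WalkOfWeight (encodeNode x) (encodeNode y) (treeDist x y)
  treeDistᵂ hub hub _ _ = emptyᵂ
  treeDistᵂ hub (node r c) _ ≤L = hubᵂ r c ≤L
  treeDistᵂ (node r c) hub ≤L _ = castᵂ refl refl (ℕₚ.+-comm Δ (routeCost r c)) (reverseᵂ treeWeight-sym (hubᵂ r c ≤L))
  treeDistᵂ (node r c) (node r′ c′) ≤L ≤L′ with r Fin.≟ r′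
  ... | yes refl = sameRootᵂ r [] c c′ ≤L ≤L′
  ... | no _ = castᵂ refl refl (via-hub Δ (routeCost r c) (routeCost r′ c′))
                 (reverseᵂ treeWeight-sym (hubᵂ r c ≤L) ++ᵂ hubᵂ r′ c′ ≤L′)
    where
    via-hub : ∀ Δ A B → Δ + A + (Δ + B) ≡ A + (Δ + Δ + B)
    via-hub = solve 3 (λ Δ A B → Δ :+ A :+ (Δ :+ B) := A :+ (Δ :+ Δ :+ B)) refl

  2*dM≤sameRootDist : ∀ v c c′ → 2 * dM (follow v c) (follow v c′) ≤ sameRootDist v c c′
  2*dM≤sameRootDist v [] c′ = proj₁ (2*dM≤routeCost v c′)
  2*dM≤sameRootDist v (i ∷ c) [] = proj₂ (2*dM≤routeCost v (i ∷ c))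
  2*dM≤sameRootDist v (i ∷ c) (j ∷ c′) with i Fin.≟ j
  ... | yes refl = 2*dM≤sameRootDist (neighbour v i) c c′
  ... | no _ = 2*dM-triangle (proj₂ (2*dM≤routeCost v (i ∷ c))) (proj₁ (2*dM≤routeCost v (j ∷ c′)))

  2*dM≤treeDist : (∀ x y → dM x y ≤ Δ) → ∀ r c r′ c′ → 2 * dM (follow r c) (follow r′ c′) ≤ treeDist (node r c) (node r′ c′)
  2*dM≤treeDist dM≤Δ r c r′ c′ with r Fin.≟ r′
  ... | yes refl = 2*dM≤sameRootDist r c c′
  ... | no _ = ℕₚ.≤-trans (ℕₚ.*-monoʳ-≤ 2 (dM≤Δ _ _))
                 (ℕₚ.≤-trans (ℕₚ.≤-reflexive (cong (Δ +_) (ℕₚ.+-identityʳ Δ)))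
                   (ℕₚ.≤-trans (ℕₚ.m≤m+n (Δ + Δ) (routeCost r′ c′)) (ℕₚ.m≤n+m _ (routeCost r c))))

  treeDist-spec : ∀ u v → IsWDist treeGraph (λ a b → half (treeWeight a b)) u v (half (treeDist (decodeNode u) (decodeNode v)))
  treeDist-spec u v =
    (proj₁ exact , trans (wlen-half (proj₁ exact)) (cong half (proj₂ exact))) ,
    λ w → subst (half (treeDist (decodeNode u) (decodeNode v)) ℚ.≤_) (sym (wlen-half w)) (half-mono-≤ (treeDist≤weight w))
    where
    exact : WalkOfWeight u v (treeDist (decodeNode u) (decodeNode v))
    exact = castᵂ (encodeNode-decodeNode u) (encodeNode-decodeNode v) refl
              (treeDistᵂ (decodeNode u) (decodeNode v) (decodeNode-shallow u) (decodeNode-shallow v))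

  wordTree : WeightedTree nodeCount
  wordTree = record
    { graph = treeGraph
    ; isTree = (λ u v → proj₁ (proj₁ (treeDist-spec u v))) , acyclic treeEdge-parentStep
    ; wt = λ u v → half (treeWeight u v)
    ; wt-sym = λ u v → cong half (treeWeight-sym u v)
    ; wt-nonneg = λ u v _ → subst (ℚ._≤ half (treeWeight u v)) half-0 (half-mono-≤ z≤n)
    ; dT = λ u v → half (treeDist (decodeNode u) (decodeNode v))
    ; dT-spec = treeDist-spec }

module PathLifting where

  open import Data.Nat as ℕ using (ℕ; zero; suc; _+_; _*_; _^_; _≤_; _<_; z≤n)
  import Data.Nat.Properties as ℕₚ
  open import Data.Fin as Fin using (Fin; combine; remQuot; toℕ)
  import Data.Fin.Properties as Finₚ
  open import Data.List using (List; []; _∷_; _++_; length)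
  import Data.List.Properties as Listₚ
  open import Data.List.Relation.Binary.Pointwise using (Pointwise; []; _∷_)
  open import Data.Maybe using (Maybe; just)
  import Data.Maybe.Properties as Maybeₚ
  open import Data.Product using (Σ; ∃; _×_; _,_; proj₁; proj₂)
  open import Data.Product.Properties using (×-≡,≡→≡)
  open import Data.Integer using (+_)
  open import Relation.Nullary using (yes; no)
  open import Relation.Binary.PropositionalEquality hiding ([_])
  open import Data.Rational as ℚ using (ℚ)
  open import Data.Nat.Solver using (module +-*-Solver)
  open +-*-Solver using (solve; _:+_; _:*_; _:=_; con)
  open import Function using (_∘_)
  open HalfUnits
  open FinLemmas

  extend-bound : ∀ S Δ X C ℓ L c → X ≤ 2 * ℓ → S * C ≤ (4 * S + 2 * Δ) * L + (c + ℓ) * (2 * (S + Δ)) →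
                 S * (X + C) ≤ (4 * S + 2 * Δ) * (ℓ + L) + c * (2 * (S + Δ))
  extend-bound S Δ X C ℓ L c X≤ SC≤ = begin
    S * (X + C)                                                  ≡⟨ ℕₚ.*-distribˡ-+ S X C ⟩
    S * X + S * C                                                ≤⟨ ℕₚ.+-mono-≤ (ℕₚ.*-monoʳ-≤ S X≤) SC≤ ⟩
    S * (2 * ℓ) + ((4 * S + 2 * Δ) * L + (c + ℓ) * (2 * (S + Δ))) ≡⟨ solve 5 (λ S Δ ℓ L c →
        S :* (con 2 :* ℓ) :+ ((con 4 :* S :+ con 2 :* Δ) :* L :+ (c :+ ℓ) :* (con 2 :* (S :+ Δ)))
          := (con 4 :* S :+ con 2 :* Δ) :* (ℓ :+ L) :+ c :* (con 2 :* (S :+ Δ))) refl S Δ ℓ L c ⟩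
    (4 * S + 2 * Δ) * (ℓ + L) + c * (2 * (S + Δ))                ∎
    where open ℕₚ.≤-Reasoning

  jump-bound : ∀ S Δ X C ℓ L c → X ≤ 2 * c + (Δ + Δ) → S * C ≤ (4 * S + 2 * Δ) * L → S * Δ ≤ Δ * c + (2 * S + Δ) * ℓ →
               S * (X + C) ≤ (4 * S + 2 * Δ) * (ℓ + L) + c * (2 * (S + Δ))
  jump-bound S Δ X C ℓ L c X≤ SC≤ SΔ≤ = begin
    S * (X + C)                                                  ≡⟨ ℕₚ.*-distribˡ-+ S X C ⟩
    S * X + S * C                                                ≤⟨ ℕₚ.+-mono-≤ (ℕₚ.*-monoʳ-≤ S X≤) SC≤ ⟩
    S * (2 * c + (Δ + Δ)) + (4 * S + 2 * Δ) * L                  ≡⟨ solve 4 (λ S Δ c L →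
        S :* (con 2 :* c :+ (Δ :+ Δ)) :+ (con 4 :* S :+ con 2 :* Δ) :* L
          := S :* (con 2 :* c) :+ con 2 :* (S :* Δ) :+ (con 4 :* S :+ con 2 :* Δ) :* L) refl S Δ c L ⟩
    S * (2 * c) + 2 * (S * Δ) + (4 * S + 2 * Δ) * L              ≤⟨ ℕₚ.+-monoˡ-≤ _ (ℕₚ.+-monoʳ-≤ (S * (2 * c)) (ℕₚ.*-monoʳ-≤ 2 SΔ≤)) ⟩
    S * (2 * c) + 2 * (Δ * c + (2 * S + Δ) * ℓ) + (4 * S + 2 * Δ) * L ≡⟨ solve 5 (λ S Δ c ℓ L →
        S :* (con 2 :* c) :+ con 2 :* (Δ :* c :+ (con 2 :* S :+ Δ) :* ℓ) :+ (con 4 :* S :+ con 2 :* Δ) :* L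
          := (con 4 :* S :+ con 2 :* Δ) :* (ℓ :+ L) :+ c :* (con 2 :* (S :+ Δ))) refl S Δ c ℓ L ⟩
    (4 * S + 2 * Δ) * (ℓ + L) + c * (2 * (S + Δ))                ∎
    where open ℕₚ.≤-Reasoning

  -- c is the length of the current word, ℓ the length of the next step and t the
  -- longest word used; a jump happens exactly when c + ℓ > t.
  JumpAffordable : ℕ → ℕ → ℕ → Set
  JumpAffordable S Δ t = ∀ c ℓ → c ≤ t → t < c + ℓ → S * Δ ≤ Δ * c + (2 * S + Δ) * ℓ

  jumpAffordable-depth : ∀ s Δ → JumpAffordable (suc s) Δ s
  jumpAffordable-depth s Δ c ℓ _ s<c+ℓ = begin
    suc s * Δ                    ≤⟨ ℕₚ.*-monoˡ-≤ Δ s<c+ℓ ⟩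
    (c + ℓ) * Δ                  ≡⟨ trans (ℕₚ.*-comm (c + ℓ) Δ) (ℕₚ.*-distribˡ-+ Δ c ℓ) ⟩
    Δ * c + Δ * ℓ                ≤⟨ ℕₚ.+-monoʳ-≤ (Δ * c) (ℕₚ.*-monoˡ-≤ ℓ (ℕₚ.m≤n+m Δ (2 * suc s))) ⟩
    Δ * c + (2 * suc s + Δ) * ℓ  ∎
    where open ℕₚ.≤-Reasoning

  jumpAffordable-Δ≤1 : ∀ S Δ → Δ ≤ 1 → JumpAffordable S Δ 0
  jumpAffordable-Δ≤1 S Δ Δ≤1 zero (suc ℓ) z≤n _ = begin
    S * Δ                        ≤⟨ ℕₚ.*-monoʳ-≤ S Δ≤1 ⟩
    S * 1                        ≡⟨ ℕₚ.*-identityʳ S ⟩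
    S                            ≤⟨ ℕₚ.≤-trans (ℕₚ.m≤m+n S (S + 0)) (ℕₚ.m≤m+n (2 * S) Δ) ⟩
    2 * S + Δ                    ≤⟨ ℕₚ.m≤m*n (2 * S + Δ) (suc ℓ) ⟩
    (2 * S + Δ) * suc ℓ          ≤⟨ ℕₚ.m≤n+m _ (Δ * 0) ⟩
    Δ * 0 + (2 * S + Δ) * suc ℓ  ∎
    where open ℕₚ.≤-Reasoning

  module Embedding {n : ℕ} (G : Graph n) (dM : Fin n → Fin n → ℕ) (sp : IsShortestPathMetric G dM)
           (d : ℕ) (degree≤d : ∀ u → degree G u ≤ d) (Δ : ℕ) (dM≤Δ : ∀ x y → dM x y ≤ Δ)
           (s t : ℕ) (t≤S : t ≤ suc s) (room : WordCodes.wordCount d t ≤ d ^ suc s)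
           (affordable : JumpAffordable (suc s) Δ t) where

    open ShortestPaths G dM sp
    open Routes d degree≤d
    open WordCodes d
    open WordTree G dM sp d degree≤d Δ (suc s)

    S : ℕ
    S = suc s

    k : ℕ
    k = n * d ^ S

    slot : Fin k → Fin (wordCount S)
    slot x = Fin.inject≤ (proj₂ (remQuot {n} (d ^ S) x)) (d^L≤wordCount S)

    root : Fin k → Fin n
    root x = proj₁ (remQuot {n} (d ^ S) x)

    treePoint : Fin k → Fin nodeCount
    treePoint x = Fin.suc (combine (root x) (slot x))

    decodeNode-treePoint : ∀ x → decodeNode (treePoint x) ≡ node (root x) (decode S (slot x))
    decodeNode-treePoint x = cong₂ node (cong proj₁ split≡) (cong (decode S ∘ proj₂) split≡)
      where
      split≡ = Finₚ.remQuot-combine (root x) (slot x)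

    treePoint-injective : ∀ x y → treePoint x ≡ treePoint y → x ≡ y
    treePoint-injective x y eq with Finₚ.combine-injective (root x) (slot x) (root y) (slot y) (Finₚ.suc-injective eq)
    ... | root≡ , slot≡ =
      remQuot-injective {n} (d ^ S) (×-≡,≡→≡ (root≡ , Finₚ.inject≤-injective _ _ _ _ slot≡))

    treeMetric : TreeMetric k
    treeMetric = record { m = nodeCount ; tree = wordTree ; point = treePoint ; point-inj = treePoint-injective }

    f : Fin k → Maybe (Fin n)
    f x = just (follow (root x) (decode S (slot x)))

    copy : Fin n → (c : List (Fin d)) → length c ≤ t → Fin k
    copy r c ≤t = combine r (Fin.fromℕ< (ℕₚ.<-≤-trans (toℕ-encode<wordCount S t c t≤S ≤t) room))

    root-copy : ∀ r c ≤t → root (copy r c ≤t) ≡ r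
    root-copy r c ≤t = cong proj₁ (Finₚ.remQuot-combine r _)

    word-copy : ∀ r c ≤t → decode S (slot (copy r c ≤t)) ≡ c
    word-copy r c ≤t = trans (cong (decode S) (Finₚ.toℕ-injective slot≡)) (decode-encode S c (ℕₚ.≤-trans ≤t t≤S))
      where
      open ≡-Reasoning
      slot≡ : toℕ (slot (copy r c ≤t)) ≡ toℕ (encode S c)
      slot≡ = begin
        toℕ (slot (copy r c ≤t))                        ≡⟨ Finₚ.toℕ-inject≤ _ (d^L≤wordCount S) ⟩
        toℕ (proj₂ (remQuot {n} (d ^ S) (copy r c ≤t))) ≡⟨ cong (toℕ ∘ proj₂) (Finₚ.remQuot-combine r _) ⟩
        toℕ (Fin.fromℕ< _)                              ≡⟨ Finₚ.toℕ-fromℕ< _ ⟩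
        toℕ (encode S c)                                ∎

    f-copy : ∀ r c ≤t → f (copy r c ≤t) ≡ just (follow r c)
    f-copy r c ≤t = cong just (cong₂ follow (root-copy r c ≤t) (word-copy r c ≤t))

    treeDistᵖ : Fin k → Fin k → ℕ
    treeDistᵖ x y = treeDist (decodeNode (treePoint x)) (decodeNode (treePoint y))

    decodeNode-copy : ∀ r c ≤t → decodeNode (treePoint (copy r c ≤t)) ≡ node r c
    decodeNode-copy r c ≤t = trans (decodeNode-treePoint _) (cong₂ node (root-copy r c ≤t) (word-copy r c ≤t))

    treeDistᵖ-copy : ∀ r c ≤t r′ c′ ≤t′ → treeDistᵖ (copy r c ≤t) (copy r′ c′ ≤t′) ≡ treeDist (node r c) (node r′ c′)
    treeDistᵖ-copy r c ≤t r′ c′ ≤t′ = cong₂ treeDist (decodeNode-copy r c ≤t) (decodeNode-copy r′ c′ ≤t′)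

    Lifts : Fin k → Fin n → Set
    Lifts x u = f x ≡ just u

    A B : ℕ
    A = 4 * S + 2 * Δ
    B = 2 * (S + Δ)

    -- A lifting that starts at depth |c| may exceed A/S times the length by
    -- B/S per letter of c: the budget for eventually jumping back to a root.
    Lifting : ∀ r c → length c ≤ t → List (Fin n) → Set
    Lifting r c ≤t ps = Σ (List (Fin k)) λ tail →
      Pointwise Lifts (copy r c ≤t ∷ tail) (follow r c ∷ ps) ×
      S * ℓℕ treeDistᵖ (copy r c ≤t ∷ tail) ≤ A * ℓℕ dM (follow r c ∷ ps) + length c * B

    extendLifting : ∀ r c ≤t q ≤t′ y ps → follow r (c ++ q) ≡ y → length q ≡ dM (follow r c) y →
                    Lifting r (c ++ q) ≤t′ ps → Lifting r c ≤t (y ∷ ps)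
    extendLifting r c ≤t q ≤t′ y ps follow≡ length≡ (tail , lifts , bound) =
      copy r (c ++ q) ≤t′ ∷ tail ,
      f-copy r c ≤t ∷ subst (λ z → Pointwise Lifts (copy r (c ++ q) ≤t′ ∷ tail) (z ∷ ps)) follow≡ lifts ,
      extend-bound S Δ _ _ (dM (follow r c) y) _ (length c) step≤ bound′
      where
      step≤ : treeDistᵖ (copy r c ≤t) (copy r (c ++ q) ≤t′) ≤ 2 * dM (follow r c) y
      step≤ = begin
        treeDistᵖ (copy r c ≤t) (copy r (c ++ q) ≤t′) ≡⟨ treeDistᵖ-copy r c ≤t r (c ++ q) ≤t′ ⟩
        treeDist (node r c) (node r (c ++ q))        ≡⟨ treeDist-++ r c q ⟩
        routeCost (follow r c) q                     ≤⟨ routeCost≤2*length (follow r c) q ⟩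
        2 * length q                                 ≡⟨ cong (2 *_) length≡ ⟩
        2 * dM (follow r c) y                        ∎
        where open ℕₚ.≤-Reasoning
      bound′ : S * ℓℕ treeDistᵖ (copy r (c ++ q) ≤t′ ∷ tail) ≤ A * ℓℕ dM (y ∷ ps) + (length c + dM (follow r c) y) * B
      bound′ = subst₂ (λ z l → S * ℓℕ treeDistᵖ (copy r (c ++ q) ≤t′ ∷ tail) ≤ A * ℓℕ dM (z ∷ ps) + l * B)
                      follow≡ (trans (Listₚ.length-++ c) (cong (λ l → length c + l) length≡)) bound

    jumpLifting : ∀ r c ≤t y ps → t < length c + dM (follow r c) y → Lifting y [] z≤n ps → Lifting r c ≤t (y ∷ ps)
    jumpLifting r c ≤t y ps deep (tail , lifts , bound) =
      copy y [] z≤n ∷ tail ,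
      f-copy r c ≤t ∷ lifts ,
      jump-bound S Δ _ _ (dM (follow r c) y) _ (length c) jump≤
        (subst (S * ℓℕ treeDistᵖ (copy y [] z≤n ∷ tail) ≤_) (ℕₚ.+-identityʳ _) bound)
        (affordable (length c) (dM (follow r c) y) ≤t deep)
      where
      jump≤ : treeDistᵖ (copy r c ≤t) (copy y [] z≤n) ≤ 2 * length c + (Δ + Δ)
      jump≤ = subst (_≤ 2 * length c + (Δ + Δ)) (sym (treeDistᵖ-copy r c ≤t y [] z≤n)) (treeDist-root≤ r c y)

    lift : ∀ r c ≤t ps → Lifting r c ≤t ps
    lift r c ≤t [] = [] , f-copy r c ≤t ∷ [] , ℕₚ.≤-trans (ℕₚ.≤-reflexive (ℕₚ.*-zeroʳ S)) z≤n
    lift r c ≤t (y ∷ ps) with sp (follow r c) y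
    ... | (w , ∣w∣≡) , _ with walk⇒route w
    ...   | q , follow≡ , length≡ with length (c ++ q) ℕ.≤? t
    ...     | yes ≤t′ =
      extendLifting r c ≤t q ≤t′ y ps (trans (follow-++ r c q) follow≡) (trans length≡ ∣w∣≡) (lift r (c ++ q) ≤t′ ps)
    ...     | no ≰t = jumpLifting r c ≤t y ps deep (lift y [] z≤n ps)
      where
      deep : t < length c + dM (follow r c) y
      deep = subst (t <_) (trans (Listₚ.length-++ c) (cong (λ l → length c + l) (trans length≡ ∣w∣≡))) (ℕₚ.≰⇒> ≰t)

    surjective : ∀ x → ∃ λ u → f u ≡ just x
    surjective x = copy x [] z≤n , f-copy x [] z≤n

    noncontractive : ∀ u v x y → f u ≡ just x → f v ≡ just y → (+ dM x y ℚ./ 1) ℚ.≤ dist treeMetric u v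
    noncontractive u v x y fu fv with Maybeₚ.just-injective fu | Maybeₚ.just-injective fv
    ... | refl | refl =
      subst₂ (λ a b → (+ dM x y ℚ./ 1) ℚ.≤ half (treeDist a b)) (sym (decodeNode-treePoint u)) (sym (decodeNode-treePoint v))
        (≤-half (dM x y) _ (ℕₚ.≤-trans (ℕₚ.≤-reflexive (ℕₚ.*-comm (dM x y) 2))
                                       (2*dM≤treeDist dM≤Δ (root u) (decode S (slot u)) (root v) (decode S (slot v)))))

    α : ℚ
    α = (+ 2 ℚ./ 1) ℚ.+ (+ Δ ℚ./ S)

    stretch-bounded : ∀ p → ∃ λ p′ → Pointwise Lifts p′ p × ℓℚ (dist treeMetric) p′ ℚ.≤ α ℚ.* (+ ℓℕ dM p ℚ./ 1)
    stretch-bounded [] =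
      [] , [] , subst (ℚ._≤ α ℚ.* (+ 0 ℚ./ 1)) half-0 (half-≤-stretch 0 0 Δ s (ℕₚ.≤-trans (ℕₚ.≤-reflexive (ℕₚ.*-zeroʳ S)) z≤n))
    stretch-bounded (x ∷ ps) with lift x [] z≤n ps
    ... | tail , lifts , bound =
      copy x [] z≤n ∷ tail , lifts ,
      subst (ℚ._≤ α ℚ.* (+ ℓℕ dM (x ∷ ps) ℚ./ 1)) (sym (ℓℚ-half treeDistᵖ (copy x [] z≤n ∷ tail)))
        (half-≤-stretch _ _ Δ s (ℕₚ.≤-trans bound (ℕₚ.≤-reflexive (ℕₚ.+-identityʳ _))))

    pathEmbedded : PathEmbedded dM treeMetric α
    pathEmbedded = f , surjective , noncontractive , stretch-bounded

open import Data.Nat using (zero; suc; _*_; _^_; NonZero; z≤n; s≤s)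
import Data.Nat.Properties as ℕₚ
open import Data.Product using (Σ; _,_)
open import Data.Integer using (+_)
open import Data.Rational using (_+_; _/_)
open import Relation.Binary.PropositionalEquality using (sym; subst)

proposition4p1 : (n : ℕ) (G : Graph n) (d Δ : ℕ) (dM : Fin n → Fin n → ℕ)
    → 2 ≤ n
    → Connected G
    → IsShortestPathMetric G dM
    → MaxDegree G d
    → Diameter G dM Δ
    → (s : ℕ) .{{_ : NonZero s}}
    → Σ (TreeMetric (n * d ^ s)) λ N → PathEmbedded dM N ((+ 2 / 1) + (+ Δ / s))
proposition4p1 n G d Δ dM 2≤n connected sp (degree≤d , _) (dM≤Δ , x , y , dM≡Δ) (suc s)
  with d | degree≤d | ShortestPaths.connected⇒1≤maxDegree G dM sp 2≤n connected degree≤d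
... | zero | _ | ()
... | suc zero | degree≤1 | _ = E.treeMetric , E.pathEmbedded
  where
  Δ≤1 : Δ ≤ 1
  Δ≤1 = subst (_≤ 1) dM≡Δ (ShortestPaths.degree≤1⇒dM≤1 G dM sp degree≤1 x y)
  module E = PathLifting.Embedding G dM sp 1 degree≤1 Δ dM≤Δ s 0 z≤n (ℕₚ.≤-reflexive (sym (ℕₚ.^-zeroˡ (suc s))))
               (PathLifting.jumpAffordable-Δ≤1 (suc s) Δ Δ≤1)
... | suc (suc d′) | degree≤d′ | _ = E.treeMetric , E.pathEmbedded
  where
  module E = PathLifting.Embedding G dM sp (suc (suc d′)) degree≤d′ Δ dM≤Δ s s (ℕₚ.n≤1+n s)
               (ℕₚ.<⇒≤ (WordCodes.wordCount<d^suc (suc (suc d′)) (s≤s (s≤s z≤n)) s))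
               (PathLifting.jumpAffordable-depth s Δ)
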